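{- Let $\ell$ be a prime, $A=(A_1,\dots,A_n)\in\Gamma_\ell^n$, and $A'=(\pi_\ell A_1\pi_\ell^{ -1},\dots,\pi_\ell A_n\pi_\ell^{ -1})$. Let $d=(d_1,\dots,d_n)$ with $1\le d_i\le n$ and $d\ne(1,\dots,1)$. Then the map $(x_1,x_2,\dots,x_n)\mapsto(\ell x_1,x_2,\dots,x_n)$ induces a bijection from $X'(d)\cap\mathbf{Z}^n$ onto $X(d)\cap\mathbf{Z}^n$.
   Context: $\mathbf{Z}_{(\ell)}$ is the localization of $\mathbf{Z}$ at $(\ell)$; $\Gamma_\ell$ is the group of $A\in\mathrm{GL}_n(\mathbf{Z}_{(\ell)})$ whose first column has all entries except the first divisible by $\ell$; $\pi_\ell=\mathrm{diag}(\ell,1,\dots,1)$. For a tuple $B=(B_1,\dots,B_n)$ of invertible matrices, $X(B,d)$ is the set of $x\in\mathbf{R}^n\setminus\{0\}$ such that for each $i$, the first column of $B_i$ having nonzero dot product with $x$ is its $d_i$-th column. $X(d)=X(A,d)$, $X'(d)=X(A',d)$. -}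

module Defs where

open import Data.Nat as ℕ using (ℕ; zero; suc)
open import Data.Nat.Divisibility using (_∣_)
open import Data.Integer as ℤ using (ℤ; +_)
open import Data.Rational as ℚ using (ℚ; 0ℚ; 1ℚ; _+_; _*_)
open import Data.Fin using (Fin; toℕ) renaming (zero to fzero; suc to fsuc)
open import Data.Vec using (Vec; []; _∷_; lookup; replicate)
open import Data.Product using (Σ; _×_)
open import Relation.Nullary using (¬_)
open import Relation.Binary.PropositionalEquality using (_≡_; _≢_)

-- n×n matrices over ℚ, indexed (row, column), 0-based
Mat : ℕ → Set
Mat n = Fin n → Fin n → ℚ

sumF : ∀ {n} → (Fin n → ℚ) → ℚ
sumF {zero} f = 0ℚ
sumF {suc n} f = f fzero + sumF (λ i → f (fsuc i))

_⊗_ : ∀ {n} → Mat n → Mat n → Mat n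
(A ⊗ B) i j = sumF (λ k → A i k * B k j)

idMat : ∀ {n} → Mat n
idMat i j with toℕ i ℕ.≟ toℕ j
... | Relation.Nullary.yes _ = 1ℚ
... | Relation.Nullary.no  _ = 0ℚ

-- ℓ as a rational, and 1/ℓ (ℓ = 0 gives 0; irrelevant since ℓ is prime)
ℓℚ : ℕ → ℚ
ℓℚ ℓ = (+ ℓ) ℚ./ 1

invℓ : ℕ → ℚ
invℓ zero = 0ℚ
invℓ (suc k) = (+ 1) ℚ./ suc k

-- π_ℓ = diag(ℓ,1,…,1) and π_ℓ⁻¹ = diag(1/ℓ,1,…,1)
diagFirst : ∀ {n} → ℚ → Mat n
diagFirst c i j with toℕ i ℕ.≟ toℕ j | toℕ i ℕ.≟ 0
... | Relation.Nullary.no _  | _ = 0ℚ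
... | Relation.Nullary.yes _ | Relation.Nullary.yes _ = c
... | Relation.Nullary.yes _ | Relation.Nullary.no _ = 1ℚ

πMat : ∀ {n} → ℕ → Mat n
πMat ℓ = diagFirst (ℓℚ ℓ)

πInvMat : ∀ {n} → ℕ → Mat n
πInvMat ℓ = diagFirst (invℓ ℓ)

conjπ : ∀ {n} → ℕ → Mat n → Mat n
conjπ ℓ A = (πMat ℓ ⊗ A) ⊗ πInvMat ℓ

InZℓ : ℕ → ℚ → Set
InZℓ ℓ q = ¬ (ℓ ∣ ℚ.denominatorℕ q)

DivZℓ : ℕ → ℚ → Set
DivZℓ ℓ a = Σ ℚ (λ b → InZℓ ℓ b × (a ≡ ℓℚ ℓ * b))

MatZℓ : ∀ {n} → ℕ → Mat n → Set
MatZℓ ℓ A = ∀ i j → InZℓ ℓ (A i j)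

GLZℓ : ∀ {n} → ℕ → Mat n → Set
GLZℓ {n} ℓ A = MatZℓ ℓ A × Σ (Mat n) (λ B → MatZℓ ℓ B ×
  ((∀ i j → (A ⊗ B) i j ≡ idMat i j) × (∀ i j → (B ⊗ A) i j ≡ idMat i j)))

Γ : ∀ {n} → ℕ → Mat n → Set
Γ ℓ A = GLZℓ ℓ A × (∀ i j → toℕ j ≡ 0 → toℕ i ≢ 0 → DivZℓ ℓ (A i j))

colDot : ∀ {n} → Mat n → Fin n → Vec ℤ n → ℚ
colDot B j x = sumF (λ i → B i j * ((lookup x i) ℚ./ 1))

-- x ∈ X(B,d) ∩ ℤⁿ  (d i is 0-based: d i = k means the (k+1)-th column)
InX : ∀ {n} → (Fin n → Mat n) → (Fin n → Fin n) → Vec ℤ n → Set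
InX B d x = x ≢ replicate _ (+ 0) ×
  (∀ i → colDot (B i) (d i) x ≢ 0ℚ ×
         (∀ j → toℕ j ℕ.< toℕ (d i) → colDot (B i) j x ≡ 0ℚ))

scaleFirst : ∀ {n} → ℕ → Vec ℤ n → Vec ℤ n
scaleFirst ℓ [] = []
scaleFirst ℓ (x ∷ xs) = ((+ ℓ) ℤ.* x) ∷ xs

-- Conjugation by π = diag(ℓ,1,…,1) rescales the j-th column dot product:
-- ⟨column j of πAπ⁻¹, x⟩ = (π⁻¹)ⱼⱼ ⟨column j of A, πx⟩.  Since (π⁻¹)ⱼⱼ ≠ 0, a vector x lies
-- in X′(d) exactly when πx lies in X(d), and x ↦ πx is injective.  For surjectivity
-- pick i with dᵢ ≠ 1: then y ∈ X(d) is orthogonal to the first column (a₀₀, a₁₀, …) of Aᵢ,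
-- whose entries below a₀₀ lie in ℓℤ₍ℓ₎.  With b₀₀a₀₀ + Σ b₀ₖaₖ₀ = 1 from the inverse B of Aᵢ,
-- y₀ = y₀ Σ b₀ₖaₖ₀ − b₀₀ Σ aₖ₀yₖ (sums over k ≥ 1) lies in ℓℤ₍ℓ₎ ∩ ℤ = ℓℤ, so y = πx.
{-# OPTIONS --safe #-}
module Submission where

open import Defs
open import Data.Nat using (ℕ)
open import Data.Nat.Primality using (Prime)
open import Data.Integer using (ℤ)
open import Data.Fin using (Fin; toℕ)
open import Data.Vec using (Vec)
open import Data.Product using (Σ; _×_)
open import Relation.Nullary using (¬_)
open import Relation.Binary.PropositionalEquality using (_≡_)

import Data.Nat as ℕ
import Data.Nat.Properties as ℕP
import Data.Nat.Tactic.RingSolver as ℕSolver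
open import Data.Nat.Primality using (euclidsLemma; ¬prime[0]; ¬prime[1])
open import Data.Nat.Divisibility using (_∣_; divides; ∣1⇒≡1)
open import Data.Integer using (+_; -_)
import Data.Integer as ℤ
import Data.Integer.Properties as ℤP
import Data.Integer.Divisibility.Signed as ℤ∣
import Data.Integer.Tactic.RingSolver as ℤSolver
open import Data.Rational using (ℚ; _+_; _*_; 0ℚ; 1ℚ; _/_)
import Data.Rational as ℚ
import Data.Rational.Properties as ℚP
open import Data.Rational.Unnormalised using (mkℚᵘ; *≡*)
import Data.Rational.Unnormalised as ℚᵘ
import Data.Rational.Unnormalised.Properties as ℚᵘP
open import Data.Fin using (zero; suc)
import Data.Fin.Properties as FinP
open import Data.Vec using ([]; _∷_; lookup; replicate)
import Data.Vec.Properties as VecP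
open import Data.Product using (_,_; proj₁; proj₂)
import Data.Product as Product
open import Data.Sum using (inj₁; inj₂)
open import Data.Empty using (⊥-elim)
open import Function using (_⇔_; mk⇔; Equivalence; _∘_)
import Function.Properties.Equivalence as ⇔
open import Relation.Nullary using (yes; no)
open import Relation.Nullary.Decidable using (dec⇒maybe)
open import Relation.Binary.PropositionalEquality using (_≢_; refl; sym; trans; cong; cong₂; subst; module ≡-Reasoning)
open import Level using (0ℓ)
open import Tactic.RingSolver using (solve-∀)
open import Tactic.RingSolver.Core.AlmostCommutativeRing using (AlmostCommutativeRing; fromCommutativeRing)

open Equivalence using (to; from)

-- A genuine zero test, so that the solver can cancel coefficients such as b - b.
ℚ-ring : AlmostCommutativeRing 0ℓ 0ℓ
ℚ-ring = fromCommutativeRing ℚP.+-*-commutativeRing (λ q → dec⇒maybe (0ℚ ℚP.≟ q))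

ι : ℤ → ℚ
ι a = a / 1

toℚᵘ-ι : ∀ a → ℚ.toℚᵘ (ι a) ℚᵘ.≃ mkℚᵘ a 0
toℚᵘ-ι a = ℚP.toℚᵘ-fromℚᵘ (mkℚᵘ a 0)

ι-+ : ∀ a b → ι (a ℤ.+ b) ≡ ι a + ι b
ι-+ a b = ℚP.toℚᵘ-injective (begin
  ℚ.toℚᵘ (ι (a ℤ.+ b))              ≈⟨ toℚᵘ-ι (a ℤ.+ b) ⟩
  mkℚᵘ (a ℤ.+ b) 0                  ≈⟨ *≡* (sum-numerator a b) ⟨
  mkℚᵘ a 0 ℚᵘ.+ mkℚᵘ b 0            ≈⟨ ℚᵘP.+-cong (toℚᵘ-ι a) (toℚᵘ-ι b) ⟨
  ℚ.toℚᵘ (ι a) ℚᵘ.+ ℚ.toℚᵘ (ι b)    ≈⟨ ℚP.toℚᵘ-homo-+ (ι a) (ι b) ⟨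
  ℚ.toℚᵘ (ι a + ι b)                ∎)
  where
  open ℚᵘP.≃-Reasoning
  sum-numerator : ∀ a b → (a ℤ.* + 1 ℤ.+ b ℤ.* + 1) ℤ.* + 1 ≡ (a ℤ.+ b) ℤ.* + 1
  sum-numerator = ℤSolver.solve-∀

ι-* : ∀ a b → ι (a ℤ.* b) ≡ ι a * ι b
ι-* a b = ℚP.toℚᵘ-injective (begin
  ℚ.toℚᵘ (ι (a ℤ.* b))              ≈⟨ toℚᵘ-ι (a ℤ.* b) ⟩
  mkℚᵘ (a ℤ.* b) 0                  ≈⟨ *≡* refl ⟩
  mkℚᵘ a 0 ℚᵘ.* mkℚᵘ b 0            ≈⟨ ℚᵘP.*-cong (toℚᵘ-ι a) (toℚᵘ-ι b) ⟨
  ℚ.toℚᵘ (ι a) ℚᵘ.* ℚ.toℚᵘ (ι b)    ≈⟨ ℚP.toℚᵘ-homo-* (ι a) (ι b) ⟨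
  ℚ.toℚᵘ (ι a * ι b)                ∎)
  where open ℚᵘP.≃-Reasoning

ι-pos-* : ∀ m n → ι (+ (m ℕ.* n)) ≡ ι (+ m) * ι (+ n)
ι-pos-* m n = trans (cong ι (ℤP.pos-* m n)) (ι-* (+ m) (+ n))

ι-neg : ∀ a → ι (- a) ≡ ℚ.- ι a
ι-neg a = ℚP.toℚᵘ-injective (begin
  ℚ.toℚᵘ (ι (- a))      ≈⟨ toℚᵘ-ι (- a) ⟩
  mkℚᵘ (- a) 0          ≈⟨ ℚᵘP.-‿cong (toℚᵘ-ι a) ⟨
  ℚᵘ.- ℚ.toℚᵘ (ι a)     ≈⟨ ℚP.toℚᵘ-homo‿- (ι a) ⟨
  ℚ.toℚᵘ (ℚ.- ι a)      ∎)
  where open ℚᵘP.≃-Reasoning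

ι-injective : ∀ {a b} → ι a ≡ ι b → a ≡ b
ι-injective {a} {b} ιa≡ιb with ℚᵘP.≃-trans (ℚᵘP.≃-sym (toℚᵘ-ι a)) (ℚᵘP.≃-trans (ℚP.toℚᵘ-cong ιa≡ιb) (toℚᵘ-ι b))
... | *≡* a*1≡b*1 = trans (sym (ℤP.*-identityʳ a)) (trans a*1≡b*1 (ℤP.*-identityʳ b))

sumF-cong : ∀ {n} {f g : Fin n → ℚ} → (∀ i → f i ≡ g i) → sumF f ≡ sumF g
sumF-cong {ℕ.zero}  f≗g = refl
sumF-cong {ℕ.suc n} f≗g = cong₂ _+_ (f≗g zero) (sumF-cong (f≗g ∘ suc))

sumF-*ˡ : ∀ {n} c (f : Fin n → ℚ) → sumF (λ i → c * f i) ≡ c * sumF f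
sumF-*ˡ {ℕ.zero}  c f = sym (ℚP.*-zeroʳ c)
sumF-*ˡ {ℕ.suc n} c f = trans (cong (_+_ (c * f zero)) (sumF-*ˡ c (f ∘ suc))) (sym (ℚP.*-distribˡ-+ c (f zero) _))

sumF-zero : ∀ {n} (f : Fin n → ℚ) → (∀ i → f i ≡ 0ℚ) → sumF f ≡ 0ℚ
sumF-zero {ℕ.zero}  f f≗0 = refl
sumF-zero {ℕ.suc n} f f≗0 = cong₂ _+_ (f≗0 zero) (sumF-zero (f ∘ suc) (f≗0 ∘ suc))

sumF-single : ∀ {n} (f : Fin n → ℚ) i → (∀ j → j ≢ i → f j ≡ 0ℚ) → sumF f ≡ f i
sumF-single f zero    f≗0 = trans (cong (_+_ (f zero)) (sumF-zero (f ∘ suc) (λ j → f≗0 (suc j) λ ()))) (ℚP.+-identityʳ _)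
sumF-single f (suc i) f≗0 = trans (cong₂ _+_ (f≗0 zero λ ()) (sumF-single (f ∘ suc) i λ j j≢i → f≗0 (suc j) (j≢i ∘ FinP.suc-injective))) (ℚP.+-identityˡ _)

diagFirst-offDiag : ∀ {n} c (i j : Fin n) → i ≢ j → diagFirst c i j ≡ 0ℚ
diagFirst-offDiag c i j i≢j with toℕ i ℕP.≟ toℕ j | toℕ i ℕP.≟ 0
... | no _     | _ = refl
... | yes i≡j  | _ = ⊥-elim (i≢j (FinP.toℕ-injective i≡j))

diagFirst-suc : ∀ {n} c (i : Fin n) → diagFirst c (suc i) (suc i) ≡ 1ℚ
diagFirst-suc c i with ℕ.suc (toℕ i) ℕP.≟ ℕ.suc (toℕ i)
... | no i≢i = ⊥-elim (i≢i refl)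
... | yes _  = refl

diagFirst-⊗ : ∀ {n} c (A : Mat n) i j → (diagFirst c ⊗ A) i j ≡ diagFirst c i i * A i j
diagFirst-⊗ c A i j = sumF-single _ i λ k k≢i →
  trans (cong (_* A k j) (diagFirst-offDiag c i k (k≢i ∘ sym))) (ℚP.*-zeroˡ (A k j))

⊗-diagFirst : ∀ {n} c (A : Mat n) i j → (A ⊗ diagFirst c) i j ≡ A i j * diagFirst c j j
⊗-diagFirst c A i j = sumF-single _ j λ k k≢j →
  trans (cong (A i k *_) (diagFirst-offDiag c k j k≢j)) (ℚP.*-zeroʳ (A i k))

ℓℚ-*-invℓ : ∀ ℓ .{{_ : ℕ.NonZero ℓ}} → ℓℚ ℓ * invℓ ℓ ≡ 1ℚ
ℓℚ-*-invℓ (ℕ.suc k) = ℚP.toℚᵘ-injective (begin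
  ℚ.toℚᵘ (ℓℚ (ℕ.suc k) * invℓ (ℕ.suc k))                 ≈⟨ ℚP.toℚᵘ-homo-* (ℓℚ (ℕ.suc k)) (invℓ (ℕ.suc k)) ⟩
  ℚ.toℚᵘ (ℓℚ (ℕ.suc k)) ℚᵘ.* ℚ.toℚᵘ (invℓ (ℕ.suc k))    ≈⟨ ℚᵘP.*-cong (toℚᵘ-ι (+ ℕ.suc k)) (ℚP.toℚᵘ-fromℚᵘ (mkℚᵘ (+ 1) k)) ⟩
  mkℚᵘ (+ ℕ.suc k) 0 ℚᵘ.* mkℚᵘ (+ 1) k                   ≈⟨ *≡* (cong (+_) (cross-multiplication k)) ⟩
  ℚᵘ.1ℚᵘ                                                 ∎)
  where
  open ℚᵘP.≃-Reasoning
  -- ℓ · ℓ⁻¹ ≃ 1 after cross-multiplying, written exactly as ℚᵘ unfolds it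
  cross-multiplication : ∀ k → ℕ.suc k ℕ.* 1 ℕ.* 1 ≡ ℕ.suc (k ℕ.+ 0 ℕ.* ℕ.suc k ℕ.+ 0 ℕ.* ℕ.suc (k ℕ.+ 0 ℕ.* ℕ.suc k))
  cross-multiplication = ℕSolver.solve-∀

diagFirst-*-diagFirst-inverse : ∀ ℓ .{{_ : ℕ.NonZero ℓ}} {n} (j : Fin n) →
  diagFirst (ℓℚ ℓ) j j * diagFirst (invℓ ℓ) j j ≡ 1ℚ
diagFirst-*-diagFirst-inverse ℓ zero    = ℓℚ-*-invℓ ℓ
diagFirst-*-diagFirst-inverse ℓ (suc j) = cong₂ _*_ (diagFirst-suc (ℓℚ ℓ) j) (diagFirst-suc (invℓ ℓ) j)

conjπ-entry : ∀ ℓ {n} (A : Mat n) i j → conjπ ℓ A i j ≡ (diagFirst (ℓℚ ℓ) i i * A i j) * diagFirst (invℓ ℓ) j j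
conjπ-entry ℓ A i j = trans (⊗-diagFirst (invℓ ℓ) (πMat ℓ ⊗ A) i j) (cong (_* diagFirst (invℓ ℓ) j j) (diagFirst-⊗ (ℓℚ ℓ) A i j))

diagFirst-*-ι : ∀ ℓ {n} (x : Vec ℤ n) i → diagFirst (ℓℚ ℓ) i i * ι (lookup x i) ≡ ι (lookup (scaleFirst ℓ x) i)
diagFirst-*-ι ℓ (x₀ ∷ xs) zero    = sym (ι-* (+ ℓ) x₀)
diagFirst-*-ι ℓ (x₀ ∷ xs) (suc i) = trans (cong (_* ι (lookup xs i)) (diagFirst-suc (ℓℚ ℓ) i)) (ℚP.*-identityˡ _)

colDot-conjπ : ∀ ℓ {n} (A : Mat n) j x → colDot (conjπ ℓ A) j x ≡ diagFirst (invℓ ℓ) j j * colDot A j (scaleFirst ℓ x)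
colDot-conjπ ℓ A j x = trans (sumF-cong term) (sumF-*ˡ (diagFirst (invℓ ℓ) j j) λ i → A i j * ι (lookup (scaleFirst ℓ x) i))
  where
  reassociate : ∀ p a q y → ((p * a) * q) * y ≡ q * (a * (p * y))
  reassociate = solve-∀ ℚ-ring
  term : ∀ i → conjπ ℓ A i j * ι (lookup x i) ≡ diagFirst (invℓ ℓ) j j * (A i j * ι (lookup (scaleFirst ℓ x) i))
  term i = begin
    conjπ ℓ A i j * ι (lookup x i)
      ≡⟨ cong (_* ι (lookup x i)) (conjπ-entry ℓ A i j) ⟩
    ((diagFirst (ℓℚ ℓ) i i * A i j) * diagFirst (invℓ ℓ) j j) * ι (lookup x i)
      ≡⟨ reassociate (diagFirst (ℓℚ ℓ) i i) (A i j) (diagFirst (invℓ ℓ) j j) (ι (lookup x i)) ⟩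
    diagFirst (invℓ ℓ) j j * (A i j * (diagFirst (ℓℚ ℓ) i i * ι (lookup x i)))
      ≡⟨ cong (λ t → diagFirst (invℓ ℓ) j j * (A i j * t)) (diagFirst-*-ι ℓ x i) ⟩
    diagFirst (invℓ ℓ) j j * (A i j * ι (lookup (scaleFirst ℓ x) i)) ∎
    where open ≡-Reasoning

colDot-conjπ≡0⇔ : ∀ ℓ .{{_ : ℕ.NonZero ℓ}} {n} (A : Mat n) j x →
  colDot (conjπ ℓ A) j x ≡ 0ℚ ⇔ colDot A j (scaleFirst ℓ x) ≡ 0ℚ
colDot-conjπ≡0⇔ ℓ A j x = mk⇔
  (λ c≡0 → begin
    c                ≡⟨ ℚP.*-identityˡ c ⟨
    1ℚ * c           ≡⟨ cong (_* c) (diagFirst-*-diagFirst-inverse ℓ j) ⟨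
    (π * π⁻¹) * c    ≡⟨ ℚP.*-assoc π π⁻¹ c ⟩
    π * (π⁻¹ * c)    ≡⟨ cong (π *_) (trans (sym (colDot-conjπ ℓ A j x)) c≡0) ⟩
    π * 0ℚ           ≡⟨ ℚP.*-zeroʳ π ⟩
    0ℚ               ∎)
  (λ c≡0 → trans (colDot-conjπ ℓ A j x) (trans (cong (π⁻¹ *_) c≡0) (ℚP.*-zeroʳ π⁻¹)))
  where
  open ≡-Reasoning
  π π⁻¹ c : ℚ
  π = diagFirst (ℓℚ ℓ) j j
  π⁻¹ = diagFirst (invℓ ℓ) j j
  c = colDot A j (scaleFirst ℓ x)

scaleFirst-injective : ∀ ℓ .{{_ : ℕ.NonZero ℓ}} {n} (x y : Vec ℤ n) → scaleFirst ℓ x ≡ scaleFirst ℓ y → x ≡ y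
scaleFirst-injective ℓ []         []         _  = refl
scaleFirst-injective ℓ (x₀ ∷ xs) (y₀ ∷ ys) eq =
  cong₂ _∷_ (ℤP.*-cancelˡ-≡ (+ ℓ) x₀ y₀ (VecP.∷-injectiveˡ eq)) (VecP.∷-injectiveʳ eq)

scaleFirst-zero : ∀ ℓ n → scaleFirst ℓ (replicate n (+ 0)) ≡ replicate n (+ 0)
scaleFirst-zero ℓ ℕ.zero    = refl
scaleFirst-zero ℓ (ℕ.suc n) = cong (_∷ replicate n (+ 0)) (ℤP.*-zeroʳ (+ ℓ))

scaleFirst≡0⇔ : ∀ ℓ .{{_ : ℕ.NonZero ℓ}} {n} (x : Vec ℤ n) → x ≡ replicate n (+ 0) ⇔ scaleFirst ℓ x ≡ replicate n (+ 0)
scaleFirst≡0⇔ ℓ {n} x = mk⇔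
  (λ x≡0 → trans (cong (scaleFirst ℓ) x≡0) (scaleFirst-zero ℓ n))
  (λ πx≡0 → scaleFirst-injective ℓ x _ (trans πx≡0 (sym (scaleFirst-zero ℓ n))))

InX-≡0-transfer : ∀ {n} {B C : Fin n → Mat n} {d : Fin n → Fin n} {x y : Vec ℤ n} →
  (x ≡ replicate n (+ 0) ⇔ y ≡ replicate n (+ 0)) →
  (∀ i j → colDot (B i) j x ≡ 0ℚ ⇔ colDot (C i) j y ≡ 0ℚ) →
  InX B d x → InX C d y
InX-≡0-transfer {d = d} x≡0⇔ col≡0⇔ (x≢0 , columns) =
  x≢0 ∘ from x≡0⇔ ,
  λ i → Product.map (_∘ from (col≡0⇔ i (d i))) (λ earlier j j<dᵢ → to (col≡0⇔ i j) (earlier j j<dᵢ)) (columns i)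

InX-≡0-cong : ∀ {n} {B C : Fin n → Mat n} {d : Fin n → Fin n} {x y : Vec ℤ n} →
  (x ≡ replicate n (+ 0) ⇔ y ≡ replicate n (+ 0)) →
  (∀ i j → colDot (B i) j x ≡ 0ℚ ⇔ colDot (C i) j y ≡ 0ℚ) →
  InX B d x ⇔ InX C d y
InX-≡0-cong {B = B} {C} x≡0⇔ col≡0⇔ =
  mk⇔ (InX-≡0-transfer {B = B} {C} x≡0⇔ col≡0⇔) (InX-≡0-transfer {B = C} {B} (⇔.sym x≡0⇔) λ i j → ⇔.sym (col≡0⇔ i j))

InX-conjπ⇔ : ∀ ℓ .{{_ : ℕ.NonZero ℓ}} {n} (A : Fin n → Mat n) d (x : Vec ℤ n) →
  InX (λ i → conjπ ℓ (A i)) d x ⇔ InX A d (scaleFirst ℓ x)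
InX-conjπ⇔ ℓ A d x = InX-≡0-cong {B = λ i → conjπ ℓ (A i)} {A} (scaleFirst≡0⇔ ℓ x) λ i j → colDot-conjπ≡0⇔ ℓ (A i) j x

ba+s≡1∧ay+t≡0⇒y≡ys-bt : ∀ {y b a s t} → b * a + s ≡ 1ℚ → a * y + t ≡ 0ℚ → y ≡ y * s + ℚ.- b * t
ba+s≡1∧ay+t≡0⇒y≡ys-bt {y} {b} {a} {s} {t} ba+s≡1 ay+t≡0 = begin
  y                                        ≡⟨ ℚP.+-identityʳ y ⟨
  y + 0ℚ                                   ≡⟨ cong₂ _+_ (ℚP.*-identityʳ y) (ℚP.*-zeroʳ (ℚ.- b)) ⟨
  y * 1ℚ + ℚ.- b * 0ℚ                      ≡⟨ cong₂ (λ u v → y * u + ℚ.- b * v) ba+s≡1 ay+t≡0 ⟨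
  y * (b * a + s) + ℚ.- b * (a * y + t)    ≡⟨ cancel y b a s t ⟩
  y * s + ℚ.- b * t                        ∎
  where
  open ≡-Reasoning
  cancel : ∀ y b a s t → y * (b * a + s) + ℚ.- b * (a * y + t) ≡ y * s + ℚ.- b * t
  cancel = solve-∀ ℚ-ring

module Localisation {ℓ : ℕ} (ℓ-prime : Prime ℓ) where

  ∤1 : ¬ ℓ ∣ 1
  ∤1 ℓ∣1 = ¬prime[1] (subst Prime (∣1⇒≡1 ℓ∣1) ℓ-prime)

  ∤-* : ∀ {a b} → ¬ ℓ ∣ a → ¬ ℓ ∣ b → ¬ ℓ ∣ a ℕ.* b
  ∤-* {a} {b} ℓ∤a ℓ∤b ℓ∣ab with euclidsLemma a b ℓ-prime ℓ∣ab
  ... | inj₁ ℓ∣a = ℓ∤a ℓ∣a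
  ... | inj₂ ℓ∣b = ℓ∤b ℓ∣b

  -- membership in ℤ₍ℓ₎ witnessed by any denominator prime to ℓ, not only the reduced one
  record Integral (q : ℚ) : Set where
    constructor integral
    field
      denominator   : ℕ
      ℓ∤denominator : ¬ ℓ ∣ denominator
      numerator     : ℤ
      cleared       : q * ι (+ denominator) ≡ ι numerator

  record Divisible (q : ℚ) : Set where
    constructor divisible
    field
      quotient          : ℚ
      quotient-integral : Integral quotient
      ≡ℓ*quotient       : q ≡ ℓℚ ℓ * quotient

  InZℓ⇒Integral : ∀ {q} → InZℓ ℓ q → Integral q
  InZℓ⇒Integral {q@(ℚ.mkℚ a b-1 _)} ℓ∤b = integral (ℕ.suc b-1) ℓ∤b a (ℚP.toℚᵘ-injective (begin
    ℚ.toℚᵘ (q * ι (+ ℕ.suc b-1))                  ≈⟨ ℚP.toℚᵘ-homo-* q (ι (+ ℕ.suc b-1)) ⟩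
    mkℚᵘ a b-1 ℚᵘ.* ℚ.toℚᵘ (ι (+ ℕ.suc b-1))      ≈⟨ ℚᵘP.*-cong (ℚᵘP.≃-refl {mkℚᵘ a b-1}) (toℚᵘ-ι (+ ℕ.suc b-1)) ⟩
    mkℚᵘ a b-1 ℚᵘ.* mkℚᵘ (+ ℕ.suc b-1) 0          ≈⟨ *≡* (trans (ℤP.*-identityʳ _) (cong (λ m → a ℤ.* + m) (sym (ℕP.*-identityʳ (ℕ.suc b-1))))) ⟩
    mkℚᵘ a 0                                      ≈⟨ toℚᵘ-ι a ⟨
    ℚ.toℚᵘ (ι a)                                  ∎))
    where open ℚᵘP.≃-Reasoning

  Integral-ι : ∀ a → Integral (ι a)
  Integral-ι a = integral 1 ∤1 a (ℚP.*-identityʳ (ι a))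

  Integral-+ : ∀ {p q} → Integral p → Integral q → Integral (p + q)
  Integral-+ {p} {q} (integral b ℓ∤b a pb≡a) (integral d ℓ∤d c qd≡c) = integral (b ℕ.* d) (∤-* ℓ∤b ℓ∤d) (a ℤ.* + d ℤ.+ c ℤ.* + b) (begin
    (p + q) * ι (+ (b ℕ.* d))                     ≡⟨ cong ((p + q) *_) (ι-pos-* b d) ⟩
    (p + q) * (ι (+ b) * ι (+ d))                 ≡⟨ distribute p q (ι (+ b)) (ι (+ d)) ⟩
    (p * ι (+ b)) * ι (+ d) + (q * ι (+ d)) * ι (+ b)
                                                  ≡⟨ cong₂ (λ u v → u * ι (+ d) + v * ι (+ b)) pb≡a qd≡c ⟩
    ι a * ι (+ d) + ι c * ι (+ b)                 ≡⟨ cong₂ _+_ (ι-* a (+ d)) (ι-* c (+ b)) ⟨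
    ι (a ℤ.* + d) + ι (c ℤ.* + b)                 ≡⟨ ι-+ (a ℤ.* + d) (c ℤ.* + b) ⟨
    ι (a ℤ.* + d ℤ.+ c ℤ.* + b)                   ∎)
    where
    open ≡-Reasoning
    distribute : ∀ p q u v → (p + q) * (u * v) ≡ (p * u) * v + (q * v) * u
    distribute = solve-∀ ℚ-ring

  Integral-* : ∀ {p q} → Integral p → Integral q → Integral (p * q)
  Integral-* {p} {q} (integral b ℓ∤b a pb≡a) (integral d ℓ∤d c qd≡c) = integral (b ℕ.* d) (∤-* ℓ∤b ℓ∤d) (a ℤ.* c) (begin
    (p * q) * ι (+ (b ℕ.* d))           ≡⟨ cong ((p * q) *_) (ι-pos-* b d) ⟩
    (p * q) * (ι (+ b) * ι (+ d))       ≡⟨ interchange p q (ι (+ b)) (ι (+ d)) ⟩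
    (p * ι (+ b)) * (q * ι (+ d))       ≡⟨ cong₂ _*_ pb≡a qd≡c ⟩
    ι a * ι c                           ≡⟨ ι-* a c ⟨
    ι (a ℤ.* c)                         ∎)
    where
    open ≡-Reasoning
    interchange : ∀ p q u v → (p * q) * (u * v) ≡ (p * u) * (q * v)
    interchange = solve-∀ ℚ-ring

  Integral-neg : ∀ {p} → Integral p → Integral (ℚ.- p)
  Integral-neg {p} (integral b ℓ∤b a pb≡a) =
    integral b ℓ∤b (- a) (trans (sym (ℚP.neg-distribˡ-* p (ι (+ b)))) (trans (cong ℚ.-_ pb≡a) (sym (ι-neg a))))

  DivZℓ⇒Divisible : ∀ {q} → DivZℓ ℓ q → Divisible q
  DivZℓ⇒Divisible (r , r∈ℤ₍ℓ₎ , q≡ℓr) = divisible r (InZℓ⇒Integral r∈ℤ₍ℓ₎) q≡ℓr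

  Divisible-+ : ∀ {p q} → Divisible p → Divisible q → Divisible (p + q)
  Divisible-+ (divisible r r-int p≡ℓr) (divisible s s-int q≡ℓs) =
    divisible (r + s) (Integral-+ r-int s-int) (trans (cong₂ _+_ p≡ℓr q≡ℓs) (sym (ℚP.*-distribˡ-+ (ℓℚ ℓ) r s)))

  Divisible-sumF : ∀ {n} (f : Fin n → ℚ) → (∀ i → Divisible (f i)) → Divisible (sumF f)
  Divisible-sumF {ℕ.zero}  f _        = divisible 0ℚ (Integral-ι (+ 0)) (sym (ℚP.*-zeroʳ (ℓℚ ℓ)))
  Divisible-sumF {ℕ.suc n} f f-div = Divisible-+ (f-div zero) (Divisible-sumF (f ∘ suc) (f-div ∘ suc))

  Divisible-*ˡ : ∀ {p q} → Integral p → Divisible q → Divisible (p * q)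
  Divisible-*ˡ {p} p-int (divisible r r-int q≡ℓr) =
    divisible (p * r) (Integral-* p-int r-int) (trans (cong (p *_) q≡ℓr) (swap p (ℓℚ ℓ) r))
    where
    swap : ∀ p l r → p * (l * r) ≡ l * (p * r)
    swap = solve-∀ ℚ-ring

  Divisible-*ʳ : ∀ {p q} → Divisible p → Integral q → Divisible (p * q)
  Divisible-*ʳ {p} {q} p-div q-int = subst Divisible (ℚP.*-comm q p) (Divisible-*ˡ q-int p-div)

  Divisible-ι⇒∣ : ∀ {y} → Divisible (ι y) → + ℓ ℤ∣.∣ y
  Divisible-ι⇒∣ {y} (divisible r (integral b ℓ∤b a rb≡a) y≡ℓr) = ℤ∣.∣ᵤ⇒∣ ℓ∣∣y∣
    where
    yb≡ℓa : y ℤ.* + b ≡ + ℓ ℤ.* a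
    yb≡ℓa = ι-injective (begin
      ι (y ℤ.* + b)              ≡⟨ ι-* y (+ b) ⟩
      ι y * ι (+ b)              ≡⟨ cong (_* ι (+ b)) y≡ℓr ⟩
      (ℓℚ ℓ * r) * ι (+ b)       ≡⟨ ℚP.*-assoc (ℓℚ ℓ) r (ι (+ b)) ⟩
      ℓℚ ℓ * (r * ι (+ b))       ≡⟨ cong (ℓℚ ℓ *_) rb≡a ⟩
      ℓℚ ℓ * ι a                 ≡⟨ ι-* (+ ℓ) a ⟨
      ι (+ ℓ ℤ.* a)              ∎)
      where open ≡-Reasoning
    ℓ∣∣y∣b : ℓ ∣ ℤ.∣ y ∣ ℕ.* b
    ℓ∣∣y∣b = divides ℤ.∣ a ∣ (begin
      ℤ.∣ y ∣ ℕ.* b          ≡⟨ ℤP.abs-* y (+ b) ⟨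
      ℤ.∣ y ℤ.* + b ∣        ≡⟨ cong ℤ.∣_∣ yb≡ℓa ⟩
      ℤ.∣ + ℓ ℤ.* a ∣        ≡⟨ ℤP.abs-* (+ ℓ) a ⟩
      ℓ ℕ.* ℤ.∣ a ∣          ≡⟨ ℕP.*-comm ℓ ℤ.∣ a ∣ ⟩
      ℤ.∣ a ∣ ℕ.* ℓ          ∎)
      where open ≡-Reasoning
    ℓ∣∣y∣ : ℓ ∣ ℤ.∣ y ∣
    ℓ∣∣y∣ with euclidsLemma ℤ.∣ y ∣ b ℓ-prime ℓ∣∣y∣b
    ... | inj₁ ℓ∣∣y∣ = ℓ∣∣y∣
    ... | inj₂ ℓ∣b   = ⊥-elim (ℓ∤b ℓ∣b)

  Γ-colDot₀≡0⇒∣head : ∀ {n} (A : Mat (ℕ.suc n)) → Γ ℓ A → ∀ y₀ ys →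
    colDot A zero (y₀ ∷ ys) ≡ 0ℚ → + ℓ ℤ∣.∣ y₀
  Γ-colDot₀≡0⇒∣head A ((_ , B , B-integral , _ , BA≡I) , column₀) y₀ ys Ay≡0 =
    Divisible-ι⇒∣ (subst Divisible (sym y₀≡y₀s-bt)
      (Divisible-+ (Divisible-*ˡ (Integral-ι y₀) s-div)
                   (Divisible-*ˡ (Integral-neg {B zero zero} (InZℓ⇒Integral (B-integral zero zero))) t-div)))
    where
    s t : ℚ
    s = sumF (λ k → B zero (suc k) * A (suc k) zero)
    t = sumF (λ k → A (suc k) zero * ι (lookup ys k))
    below-div : ∀ k → Divisible (A (suc k) zero)
    below-div k = DivZℓ⇒Divisible (column₀ (suc k) zero refl λ ())
    s-div : Divisible s
    s-div = Divisible-sumF _ λ k → Divisible-*ˡ (InZℓ⇒Integral {B zero (suc k)} (B-integral zero (suc k))) (below-div k)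
    t-div : Divisible t
    t-div = Divisible-sumF _ λ k → Divisible-*ʳ (below-div k) (Integral-ι (lookup ys k))
    y₀≡y₀s-bt : ι y₀ ≡ ι y₀ * s + ℚ.- B zero zero * t
    y₀≡y₀s-bt = ba+s≡1∧ay+t≡0⇒y≡ys-bt {b = B zero zero} {A zero zero} {t = t} (BA≡I zero zero) Ay≡0

scaleFirst-preimage : ∀ ℓ {n} y₀ (ys : Vec ℤ n) → + ℓ ℤ∣.∣ y₀ → Σ (Vec ℤ (ℕ.suc n)) λ x → scaleFirst ℓ x ≡ y₀ ∷ ys
scaleFirst-preimage ℓ y₀ ys (ℤ∣.divides q y₀≡qℓ) = q ∷ ys , cong (_∷ ys) (trans (ℤP.*-comm (+ ℓ) q) (sym y₀≡qℓ))

lemma2p2 : (ℓ : ℕ) → Prime ℓ → (n : ℕ) → (A : Fin n → Mat n) → (∀ i → Γ ℓ (A i)) →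
    (d : Fin n → Fin n) → ¬ (∀ i → toℕ (d i) ≡ 0) →
    let A′ = λ i → conjπ ℓ (A i) in
    ((x : Vec ℤ n) → InX A′ d x → InX A d (scaleFirst ℓ x)) ×
    ((x y : Vec ℤ n) → InX A′ d x → InX A′ d y → scaleFirst ℓ x ≡ scaleFirst ℓ y → x ≡ y) ×
    ((y : Vec ℤ n) → InX A d y → Σ (Vec ℤ n) (λ x → InX A′ d x × scaleFirst ℓ x ≡ y))
lemma2p2 ℕ.zero ℓ-prime = ⊥-elim (¬prime[0] ℓ-prime)
lemma2p2 ℓ@(ℕ.suc _) ℓ-prime n A A∈Γ d d≢1 =
  (λ x → to (InX-conjπ⇔ ℓ A d x)) , (λ x y _ _ → scaleFirst-injective ℓ x y) , surjective
  where
  open Localisation ℓ-prime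
  surjective : (y : Vec ℤ n) → InX A d y → Σ (Vec ℤ n) λ x → InX (λ i → conjπ ℓ (A i)) d x × scaleFirst ℓ x ≡ y
  surjective [] (y≢0 , _) = ⊥-elim (y≢0 refl)
  surjective (y₀ ∷ ys) y∈X = x , from (InX-conjπ⇔ ℓ A d x) (subst (InX A d) (sym πx≡y) y∈X) , πx≡y
    where
    non-first : Σ (Fin n) λ i → toℕ (d i) ≢ 0
    non-first = FinP.¬∀⟶∃¬ n _ (λ i → toℕ (d i) ℕP.≟ 0) d≢1
    i : Fin n
    i = proj₁ non-first
    y⊥column₀ : colDot (A i) zero (y₀ ∷ ys) ≡ 0ℚ
    y⊥column₀ = proj₂ (proj₂ y∈X i) zero (ℕP.n≢0⇒n>0 (proj₂ non-first))
    preimage : Σ (Vec ℤ n) λ x → scaleFirst ℓ x ≡ y₀ ∷ ys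
    preimage = scaleFirst-preimage ℓ y₀ ys (Γ-colDot₀≡0⇒∣head (A i) (A∈Γ i) y₀ ys y⊥column₀)
    x : Vec ℤ n
    x = proj₁ preimage
    πx≡y : scaleFirst ℓ x ≡ y₀ ∷ ys
    πx≡y = proj₂ preimage
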